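{- For every positive integer $l$, there exists a graph $G$ such that $def(G)>0$ and $W_{def}(G)-w_{def}(G)\geq l$.
   Context: All graphs are finite, undirected, without loops or multiple edges. A proper $t$-edge-coloring of $G$ is a map $\alpha:E(G)\to\{1,\ldots,t\}$ such that all $t$ colors are used and adjacent edges receive different colors. The spectrum $S(v,\alpha)$ of a vertex $v$ is the set of colors on edges incident to $v$. For a finite set $A$ of integers, $def(A)=\max A-\min A-|A|+1$ ($def(\emptyset)=0$). Define $def(v,\alpha)=def(S(v,\alpha))$, $def(G,\alpha)=\sum_{v\in V(G)}def(v,\alpha)$, and $def(G)=\min_\alpha def(G,\alpha)$ over all proper edge-colorings $\alpha$ of $G$. $w_{def}(G)$ and $W_{def}(G)$ are the smallest and largest $t$ such that $G$ has a proper $t$-edge-coloring $\alpha$ with $def(G,\alpha)=def(G)$. -}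

module Defs where

open import Data.Nat using (ℕ; zero; suc; _+_; _∸_; _≤_; _<_; _⊔_; _⊓_; _≟_)
open import Data.Fin using (Fin)
open import Data.Bool using (Bool; true; false)
open import Data.Nat.ListAction using (sum)
open import Data.List using (List; []; _∷_; map; foldr; length; allFin; filterᵇ; deduplicate)
open import Data.Product using (Σ; ∃; _×_; _,_)
open import Relation.Binary.PropositionalEquality using (_≡_; _≢_)

record Graph : Set where
  field
    n     : ℕ
    adj   : Fin n → Fin n → Bool
    sym   : ∀ u v → adj u v ≡ adj v u
    irrfl : ∀ v → adj v v ≡ false
open Graph public

-- An edge colouring assigns a colour to each ordered pair; only the values
-- on edges matter (and they are required to be symmetric).
Colouring : Graph → Set
Colouring G = Fin (n G) → Fin (n G) → ℕ

record Proper (G : Graph) (t : ℕ) (α : Colouring G) : Set where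
  field
    symm   : ∀ u v → adj G u v ≡ true → α u v ≡ α v u
    range  : ∀ u v → adj G u v ≡ true → 1 ≤ α u v × α u v ≤ t
    used   : ∀ c → 1 ≤ c → c ≤ t → ∃ λ u → ∃ λ v → adj G u v ≡ true × α u v ≡ c
    proper : ∀ u v w → adj G u v ≡ true → adj G u w ≡ true → v ≢ w → α u v ≢ α u w

spectrum : (G : Graph) → Colouring G → Fin (n G) → List ℕ
spectrum G α v = deduplicate _≟_ (map (α v) (filterᵇ (adj G v) (allFin (n G))))

-- def(A) = max A - min A - |A| + 1, def(∅) = 0, for a duplicate-free list A.
defSet : List ℕ → ℕ
defSet [] = 0
defSet (x ∷ xs) = (suc (foldr _⊔_ x xs ∸ foldr _⊓_ x xs)) ∸ length (x ∷ xs)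

defV : (G : Graph) → Colouring G → Fin (n G) → ℕ
defV G α v = defSet (spectrum G α v)

defG : (G : Graph) → Colouring G → ℕ
defG G α = sum (map (defV G α) (allFin (n G)))

IsDef : Graph → ℕ → Set
IsDef G d = (∃ λ t → ∃ λ α → Proper G t α × defG G α ≡ d)
          × (∀ t α → Proper G t α → d ≤ defG G α)

OptT : Graph → ℕ → Set
OptT G t = ∃ λ α → Proper G t α × (∀ t' α' → Proper G t' α' → defG G α ≤ defG G α')

IsWdefMin : Graph → ℕ → Set
IsWdefMin G w = OptT G w × (∀ t → OptT G t → w ≤ t)

IsWdefMax : Graph → ℕ → Set
IsWdefMax G W = OptT G W × (∀ t → OptT G t → t ≤ W)

-- Take G = K₃ together with l disjoint edges ("rungs").  The three colours on the triangle
-- are distinct, so two of them differ by at least 2 and the triangle vertex seeing those two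
-- has a gap: def(G) ≥ 1.  Colouring the triangle 1, 2, 3 leaves a single gap, and rung
-- vertices have singleton spectra whatever colours the rungs get; so def(G) = 1 is attained
-- both with all rungs coloured 1 (3 colours) and with rung j coloured 4 + j (3 + l colours).
-- A proper colouring needs at least 3 colours on the triangle and uses at most |E(G)| = 3 + l,
-- hence w_def(G) = 3 and W_def(G) = 3 + l.

module Submission where

open import Defs hiding (sym)
open import Data.Nat using (ℕ; zero; suc; _+_; _∸_; _≤_; _<_; _⊔_; _⊓_; _≟_; z≤n; s≤s; s≤s⁻¹; ⌊_/2⌋)
open import Data.Nat.Properties
open import Data.Nat.ListAction using (sum)
open import Data.Fin using (Fin; toℕ; fromℕ<) renaming (zero to fz; suc to fs)
open import Data.Fin.Properties using (toℕ-injective; toℕ-fromℕ<; toℕ<n; injective⇒≤)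
open import Data.Bool using (Bool; true; false; T?)
open import Data.List using (List; []; _∷_; map; allFin; filterᵇ; deduplicate; tabulate)
open import Data.List.Properties using (filter-none)
open import Data.List.Relation.Unary.All using (All; []; _∷_)
open import Data.List.Relation.Unary.All.Properties using (tabulate⁺)
open import Data.Product using (Σ; ∃; _×_; _,_; proj₁; proj₂)
open import Data.Sum using (_⊎_; inj₁; inj₂)
open import Relation.Nullary using (¬_; contradiction)
open import Relation.Nullary.Decidable using (dec-true; dec-false)
open import Relation.Binary using (tri<; tri≈; tri>)
open import Function using (_∘_)
open import Relation.Binary.PropositionalEquality

sum-map-zero : ∀ {A : Set} {f : A → ℕ} {xs : List A} → All (λ x → f x ≡ 0) xs → sum (map f xs) ≡ 0
sum-map-zero []             = refl
sum-map-zero (fx≡0 ∷ fxs≡0) rewrite fx≡0 = sum-map-zero fxs≡0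

m+m<n+n⇒m<n : ∀ {m n} → m + m < n + n → m < n
m+m<n+n⇒m<n m+m<n+n = ≰⇒> (λ n≤m → <⇒≱ m+m<n+n (+-mono-≤ n≤m n≤m))

⌊m/2⌋<n : ∀ {m n} → m < n + n → ⌊ m /2⌋ < n
⌊m/2⌋<n {m} m<n+n = m+m<n+n⇒m<n (≤-<-trans ⌊m/2⌋+⌊m/2⌋≤m m<n+n)
  where
  ⌊m/2⌋+⌊m/2⌋≤m : ⌊ m /2⌋ + ⌊ m /2⌋ ≤ m
  ⌊m/2⌋+⌊m/2⌋≤m = ≤-trans (+-monoʳ-≤ ⌊ m /2⌋ (⌊n/2⌋≤⌈n/2⌉ m)) (≤-reflexive (⌊n/2⌋+⌈n/2⌉≡n m))

2+m+m≡1+m+1+m : ∀ m → 2 + (m + m) ≡ suc m + suc m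
2+m+m≡1+m+1+m m = cong suc (sym (+-suc m m))

x<y<z⇒2+x≤z : ∀ {x y z} → x < y → y < z → 2 + x ≤ z
x<y<z⇒2+x≤z x<y y<z = ≤-trans (s≤s x<y) y<z

defPair : ℕ → ℕ → ℕ
defPair x y = defSet (deduplicate _≟_ (x ∷ y ∷ []))

Apart : ℕ → ℕ → Set
Apart x y = 2 + x ≤ y ⊎ 2 + y ≤ x

defPair-≢ : ∀ {x y} → x ≢ y → defPair x y ≡ suc (y ⊔ x ∸ y ⊓ x) ∸ 2
defPair-≢ {x} {y} x≢y rewrite dec-false (x ≟ y) x≢y = refl

2+x≤y⇒1≤y∸x∸1 : ∀ {x y} → 2 + x ≤ y → 1 ≤ y ∸ x ∸ 1
2+x≤y⇒1≤y∸x∸1 {zero}  (s≤s (s≤s _)) = s≤s z≤n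
2+x≤y⇒1≤y∸x∸1 {suc x} (s≤s x+2≤y)   = 2+x≤y⇒1≤y∸x∸1 x+2≤y

apart⇒defPair-pos : ∀ {x y} → Apart x y → 1 ≤ defPair x y
apart⇒defPair-pos {x} {y} (inj₁ x+2≤y)
  with x<y ← <-trans (n<1+n x) x+2≤y
  rewrite defPair-≢ (<⇒≢ x<y) | m≥n⇒m⊔n≡m (<⇒≤ x<y) | m≥n⇒m⊓n≡n (<⇒≤ x<y)
  = 2+x≤y⇒1≤y∸x∸1 x+2≤y
apart⇒defPair-pos {x} {y} (inj₂ y+2≤x)
  with y<x ← <-trans (n<1+n y) y+2≤x
  rewrite defPair-≢ (≢-sym (<⇒≢ y<x)) | m≤n⇒m⊔n≡n (<⇒≤ y<x) | m≤n⇒m⊓n≡m (<⇒≤ y<x)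
  = 2+x≤y⇒1≤y∸x∸1 y+2≤x

apart⇒3≤ : ∀ {x y t} → Apart x y → 1 ≤ x → 1 ≤ y → x ≤ t → y ≤ t → 3 ≤ t
apart⇒3≤ (inj₁ x+2≤y) 1≤x _ _ y≤t = ≤-trans (s≤s (s≤s 1≤x)) (≤-trans x+2≤y y≤t)
apart⇒3≤ (inj₂ y+2≤x) _ 1≤y x≤t _ = ≤-trans (s≤s (s≤s 1≤y)) (≤-trans y+2≤x x≤t)

distinct⇒apart : ∀ {a b c} → a ≢ b → a ≢ c → b ≢ c → Apart a b ⊎ Apart a c ⊎ Apart b c
distinct⇒apart {a} {b} {c} a≢b a≢c b≢c with <-cmp a b | <-cmp a c | <-cmp b c
... | tri≈ _ a≡b _ | _ | _ = contradiction a≡b a≢b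
... | _ | tri≈ _ a≡c _ | _ = contradiction a≡c a≢c
... | _ | _ | tri≈ _ b≡c _ = contradiction b≡c b≢c
... | tri< a<b _ _ | tri< _ _ _   | tri< b<c _ _ = inj₂ (inj₁ (inj₁ (x<y<z⇒2+x≤z a<b b<c)))
... | tri< _ _ _   | tri< a<c _ _ | tri> _ _ c<b = inj₁ (inj₁ (x<y<z⇒2+x≤z a<c c<b))
... | tri< a<b _ _ | tri> _ _ c<a | tri< b<c _ _ =
  contradiction (<-trans (<-trans a<b b<c) c<a) (<-irrefl refl)
... | tri< a<b _ _ | tri> _ _ c<a | tri> _ _ _   = inj₂ (inj₂ (inj₂ (x<y<z⇒2+x≤z c<a a<b)))
... | tri> _ _ b<a | tri< a<c _ _ | tri< _ _ _   = inj₂ (inj₂ (inj₁ (x<y<z⇒2+x≤z b<a a<c)))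
... | tri> _ _ b<a | tri< a<c _ _ | tri> _ _ c<b =
  contradiction (<-trans (<-trans a<c c<b) b<a) (<-irrefl refl)
... | tri> _ _ _   | tri> _ _ c<a | tri< b<c _ _ = inj₁ (inj₂ (x<y<z⇒2+x≤z b<c c<a))
... | tri> _ _ b<a | tri> _ _ _   | tri> _ _ c<b = inj₂ (inj₁ (inj₂ (x<y<z⇒2+x≤z c<b b<a)))

distinct⇒defPair-sum-pos : ∀ {a b c} → a ≢ b → a ≢ c → b ≢ c →
  1 ≤ defPair a b + (defPair a c + defPair b c)
distinct⇒defPair-sum-pos {a} {b} {c} a≢b a≢c b≢c with distinct⇒apart a≢b a≢c b≢c
... | inj₁ ab        = ≤-trans (apart⇒defPair-pos ab) (m≤m+n (defPair a b) _)
... | inj₂ (inj₁ ac) = ≤-trans (apart⇒defPair-pos ac)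
                         (≤-trans (m≤m+n (defPair a c) _) (m≤n+m _ (defPair a b)))
... | inj₂ (inj₂ bc) = ≤-trans (apart⇒defPair-pos bc)
                         (≤-trans (m≤n+m (defPair b c) _) (m≤n+m _ (defPair a b)))

distinct-bounded⇒3≤ : ∀ {a b c t} → a ≢ b → a ≢ c → b ≢ c →
  1 ≤ a × a ≤ t → 1 ≤ b × b ≤ t → 1 ≤ c × c ≤ t → 3 ≤ t
distinct-bounded⇒3≤ a≢b a≢c b≢c (1≤a , a≤t) (1≤b , b≤t) (1≤c , c≤t)
  with distinct⇒apart a≢b a≢c b≢c
... | inj₁ ab        = apart⇒3≤ ab 1≤a 1≤b a≤t b≤t
... | inj₂ (inj₁ ac) = apart⇒3≤ ac 1≤a 1≤c a≤t c≤t
... | inj₂ (inj₂ bc) = apart⇒3≤ bc 1≤b 1≤c b≤t c≤t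

deduplicate-const : ∀ {A : Set} (c : ℕ) (xs : List A) →
  deduplicate _≟_ (map (λ _ → c) xs) ≡ [] ⊎ deduplicate _≟_ (map (λ _ → c) xs) ≡ c ∷ []
deduplicate-const c [] = inj₁ refl
deduplicate-const c (_ ∷ xs) with deduplicate-const c xs
... | inj₁ eq rewrite eq = inj₂ refl
... | inj₂ eq rewrite eq | dec-true (c ≟ c) refl = inj₂ refl

defSet-const : ∀ {A : Set} (c : ℕ) (xs : List A) → defSet (deduplicate _≟_ (map (λ _ → c) xs)) ≡ 0
defSet-const c xs with deduplicate-const c xs
... | inj₁ eq rewrite eq = refl
... | inj₂ eq rewrite eq = n∸n≡0 c

Covers : (G : Graph) {m : ℕ} → (Fin m → Fin (n G)) → (Fin m → Fin (n G)) → Set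
Covers G src tgt = ∀ u v → adj G u v ≡ true →
  ∃ λ i → (src i ≡ u × tgt i ≡ v) ⊎ (src i ≡ v × tgt i ≡ u)

colours≤edges : ∀ (G : Graph) {m t} {α : Colouring G} {src tgt : Fin m → Fin (n G)} →
  Covers G src tgt → Proper G t α → t ≤ m
colours≤edges G {m} {t} {α} {src} {tgt} cover pr = injective⇒≤ edgeOf-injective
  where
  open Proper pr
  edgeOf : (c : Fin t) → Σ (Fin m) λ i → α (src i) (tgt i) ≡ suc (toℕ c)
  edgeOf c with used (suc (toℕ c)) (s≤s z≤n) (toℕ<n c)
  ... | u , v , uv , αuv≡c with cover u v uv
  ...   | i , inj₁ (refl , refl) = i , αuv≡c
  ...   | i , inj₂ (refl , refl) = i , trans (sym (symm _ _ uv)) αuv≡c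
  edgeOf-injective : ∀ {c c′} → proj₁ (edgeOf c) ≡ proj₁ (edgeOf c′) → c ≡ c′
  edgeOf-injective {c} {c′} eq = toℕ-injective (suc-injective (begin
    suc (toℕ c)                                           ≡⟨ sym (proj₂ (edgeOf c)) ⟩
    α (src (proj₁ (edgeOf c))) (tgt (proj₁ (edgeOf c)))   ≡⟨ cong (λ i → α (src i) (tgt i)) eq ⟩
    α (src (proj₁ (edgeOf c′))) (tgt (proj₁ (edgeOf c′))) ≡⟨ proj₂ (edgeOf c′) ⟩
    suc (toℕ c′)                                          ∎))
    where open ≡-Reasoning

minimal⇒optimal : ∀ {G d t} {α : Colouring G} → (∀ t′ α′ → Proper G t′ α′ → d ≤ defG G α′) →
  Proper G t α → defG G α ≡ d → OptT G t
minimal⇒optimal {α = α} minimal pr refl = α , pr , minimal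

data Partners : ℕ → ℕ → Set where
  partners₀₁ : Partners 0 1
  partners₁₀ : Partners 1 0
  partners+2 : ∀ {x y} → Partners x y → Partners (2 + x) (2 + y)

partnersᵇ : ℕ → ℕ → Bool
partnersᵇ 0 1 = true
partnersᵇ 1 0 = true
partnersᵇ (suc (suc x)) (suc (suc y)) = partnersᵇ x y
partnersᵇ _ _ = false

partnersᵇ⇒Partners : ∀ {x y} → partnersᵇ x y ≡ true → Partners x y
partnersᵇ⇒Partners {0}           {1}           _  = partners₀₁
partnersᵇ⇒Partners {1}           {0}           _  = partners₁₀
partnersᵇ⇒Partners {suc (suc x)} {suc (suc y)} eq = partners+2 (partnersᵇ⇒Partners eq)
partnersᵇ⇒Partners {0}           {0}           ()
partnersᵇ⇒Partners {0}           {suc (suc _)} ()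
partnersᵇ⇒Partners {1}           {1}           ()
partnersᵇ⇒Partners {1}           {suc (suc _)} ()
partnersᵇ⇒Partners {suc (suc _)} {0}           ()
partnersᵇ⇒Partners {suc (suc _)} {1}           ()

Partners⇒partnersᵇ : ∀ {x y} → Partners x y → partnersᵇ x y ≡ true
Partners⇒partnersᵇ partners₀₁     = refl
Partners⇒partnersᵇ partners₁₀     = refl
Partners⇒partnersᵇ (partners+2 p) = Partners⇒partnersᵇ p

Partners-sym : ∀ {x y} → Partners x y → Partners y x
Partners-sym partners₀₁     = partners₁₀
Partners-sym partners₁₀     = partners₀₁
Partners-sym (partners+2 p) = partners+2 (Partners-sym p)

Partners-irrefl : ∀ {x} → ¬ Partners x x
Partners-irrefl (partners+2 p) = Partners-irrefl p

Partners-functional : ∀ {x y z} → Partners x y → Partners x z → y ≡ z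
Partners-functional partners₀₁     partners₀₁     = refl
Partners-functional partners₁₀     partners₁₀     = refl
Partners-functional (partners+2 p) (partners+2 q) = cong (2 +_) (Partners-functional p q)

Partners-⌊/2⌋ : ∀ {x y} → Partners x y → ⌊ x /2⌋ ≡ ⌊ y /2⌋
Partners-⌊/2⌋ partners₀₁     = refl
Partners-⌊/2⌋ partners₁₀     = refl
Partners-⌊/2⌋ (partners+2 p) = cong suc (Partners-⌊/2⌋ p)

Partners-double : ∀ j → Partners (j + j) (suc (j + j))
Partners-double zero    = partners₀₁
Partners-double (suc j) = subst₂ Partners (2+m+m≡1+m+1+m j) (cong suc (2+m+m≡1+m+1+m j))
  (partners+2 (Partners-double j))

Partners⇒double : ∀ {x y} → Partners x y →
  ∃ λ j → (x ≡ j + j × y ≡ suc (j + j)) ⊎ (y ≡ j + j × x ≡ suc (j + j))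
Partners⇒double partners₀₁ = 0 , inj₁ (refl , refl)
Partners⇒double partners₁₀ = 0 , inj₂ (refl , refl)
Partners⇒double (partners+2 p) with Partners⇒double p
... | j , inj₁ (refl , refl) = suc j , inj₁ (2+m+m≡1+m+1+m j , cong suc (2+m+m≡1+m+1+m j))
... | j , inj₂ (refl , refl) = suc j , inj₂ (2+m+m≡1+m+1+m j , cong suc (2+m+m≡1+m+1+m j))

-- Vertices 0, 1, 2 span the triangle and 3 + x is adjacent to 3 + y when x, y are partners,
-- i.e. {x, y} = {2j, 2j + 1}; for j < l these are the rungs.
adjℕ : ℕ → ℕ → Bool
adjℕ 0 1 = true
adjℕ 0 2 = true
adjℕ 1 0 = true
adjℕ 1 2 = true
adjℕ 2 0 = true
adjℕ 2 1 = true
adjℕ (suc (suc (suc x))) (suc (suc (suc y))) = partnersᵇ x y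
adjℕ _ _ = false

data Edge : ℕ → ℕ → Set where
  edge₀₁ : Edge 0 1
  edge₀₂ : Edge 0 2
  edge₁₀ : Edge 1 0
  edge₁₂ : Edge 1 2
  edge₂₀ : Edge 2 0
  edge₂₁ : Edge 2 1
  rung   : ∀ {x y} → Partners x y → Edge (3 + x) (3 + y)

adjℕ⇒Edge : ∀ {a b} → adjℕ a b ≡ true → Edge a b
adjℕ⇒Edge {0} {1} _ = edge₀₁
adjℕ⇒Edge {0} {2} _ = edge₀₂
adjℕ⇒Edge {1} {0} _ = edge₁₀
adjℕ⇒Edge {1} {2} _ = edge₁₂
adjℕ⇒Edge {2} {0} _ = edge₂₀
adjℕ⇒Edge {2} {1} _ = edge₂₁
adjℕ⇒Edge {suc (suc (suc _))} {suc (suc (suc _))} xy = rung (partnersᵇ⇒Partners xy)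
adjℕ⇒Edge {0} {0} ()
adjℕ⇒Edge {0} {suc (suc (suc _))} ()
adjℕ⇒Edge {1} {1} ()
adjℕ⇒Edge {1} {suc (suc (suc _))} ()
adjℕ⇒Edge {2} {2} ()
adjℕ⇒Edge {2} {suc (suc (suc _))} ()
adjℕ⇒Edge {suc (suc (suc _))} {0} ()
adjℕ⇒Edge {suc (suc (suc _))} {1} ()
adjℕ⇒Edge {suc (suc (suc _))} {2} ()

Edge⇒adjℕ : ∀ {a b} → Edge a b → adjℕ a b ≡ true
Edge⇒adjℕ edge₀₁   = refl
Edge⇒adjℕ edge₀₂   = refl
Edge⇒adjℕ edge₁₀   = refl
Edge⇒adjℕ edge₁₂   = refl
Edge⇒adjℕ edge₂₀   = refl
Edge⇒adjℕ edge₂₁   = refl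
Edge⇒adjℕ (rung p) = Partners⇒partnersᵇ p

Edge-sym : ∀ {a b} → Edge a b → Edge b a
Edge-sym edge₀₁   = edge₁₀
Edge-sym edge₀₂   = edge₂₀
Edge-sym edge₁₀   = edge₀₁
Edge-sym edge₁₂   = edge₂₁
Edge-sym edge₂₀   = edge₀₂
Edge-sym edge₂₁   = edge₁₂
Edge-sym (rung p) = rung (Partners-sym p)

Edge-irrefl : ∀ {a} → ¬ Edge a a
Edge-irrefl (rung p) = Partners-irrefl p

adjℕ-sym : ∀ a b → adjℕ a b ≡ adjℕ b a
adjℕ-sym a b with adjℕ a b in ab | adjℕ b a in ba
... | true  | true  = refl
... | false | false = refl
... | true  | false =
  contradiction (trans (sym (Edge⇒adjℕ (Edge-sym (adjℕ⇒Edge {a} {b} ab)))) ba) λ ()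
... | false | true  =
  contradiction (trans (sym (Edge⇒adjℕ (Edge-sym (adjℕ⇒Edge {b} {a} ba)))) ab) λ ()

adjℕ-irrefl : ∀ a → adjℕ a a ≡ false
adjℕ-irrefl a with adjℕ a a in aa
... | true  = contradiction (adjℕ⇒Edge {a} {a} aa) Edge-irrefl
... | false = refl

module TriangleAndMatching (l : ℕ) where

  N : ℕ
  N = 3 + (l + l)

  G : Graph
  G = record
    { n     = N
    ; adj   = λ u v → adjℕ (toℕ u) (toℕ v)
    ; sym   = λ u v → adjℕ-sym (toℕ u) (toℕ v)
    ; irrfl = λ v → adjℕ-irrefl (toℕ v)
    }

  v₀ v₁ v₂ : Fin N
  v₀ = fz
  v₁ = fs fz
  v₂ = fs (fs fz)

  rung-vertices : List (Fin N)
  rung-vertices = tabulate (λ i → fs (fs (fs i)))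

  neighbours : Fin N → List (Fin N)
  neighbours v = filterᵇ (adj G v) (allFin N)

  neighbours-v₀ : neighbours v₀ ≡ v₁ ∷ v₂ ∷ []
  neighbours-v₀ = cong (λ vs → v₁ ∷ v₂ ∷ vs)
    (filter-none (T? ∘ adj G v₀) {rung-vertices} (tabulate⁺ λ _ ()))

  neighbours-v₁ : neighbours v₁ ≡ v₀ ∷ v₂ ∷ []
  neighbours-v₁ = cong (λ vs → v₀ ∷ v₂ ∷ vs)
    (filter-none (T? ∘ adj G v₁) {rung-vertices} (tabulate⁺ λ _ ()))

  neighbours-v₂ : neighbours v₂ ≡ v₀ ∷ v₁ ∷ []
  neighbours-v₂ = cong (λ vs → v₀ ∷ v₁ ∷ vs)
    (filter-none (T? ∘ adj G v₂) {rung-vertices} (tabulate⁺ λ _ ()))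

  module _ (α : Colouring G) where

    defV-v₀ : defV G α v₀ ≡ defPair (α v₀ v₁) (α v₀ v₂)
    defV-v₀ = cong (defSet ∘ deduplicate _≟_ ∘ map (α v₀)) neighbours-v₀

    defV-v₁ : defV G α v₁ ≡ defPair (α v₁ v₀) (α v₁ v₂)
    defV-v₁ = cong (defSet ∘ deduplicate _≟_ ∘ map (α v₁)) neighbours-v₁

    defV-v₂ : defV G α v₂ ≡ defPair (α v₂ v₀) (α v₂ v₁)
    defV-v₂ = cong (defSet ∘ deduplicate _≟_ ∘ map (α v₂)) neighbours-v₂

    defV-triangle≤defG : defV G α v₀ + (defV G α v₁ + defV G α v₂) ≤ defG G α
    defV-triangle≤defG = +-monoʳ-≤ (defV G α v₀) (+-monoʳ-≤ (defV G α v₁) (m≤m+n (defV G α v₂) _))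

  module TriangleColours {t : ℕ} {α : Colouring G} (pr : Proper G t α) where
    open Proper pr

    a b c : ℕ
    a = α v₀ v₁
    b = α v₀ v₂
    c = α v₁ v₂

    a≢b : a ≢ b
    a≢b = proper v₀ v₁ v₂ refl refl λ ()

    a≢c : a ≢ c
    a≢c a≡c = proper v₁ v₀ v₂ refl refl (λ ()) (trans (symm v₁ v₀ refl) a≡c)

    b≢c : b ≢ c
    b≢c b≡c = proper v₂ v₀ v₁ refl refl (λ ())
      (trans (symm v₂ v₀ refl) (trans b≡c (symm v₁ v₂ refl)))

    defG-pos : 1 ≤ defG G α
    defG-pos = ≤-trans (subst (1 ≤_) triangle-defects (distinct⇒defPair-sum-pos a≢b a≢c b≢c))
                       (defV-triangle≤defG α)
      where
      open ≡-Reasoning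
      triangle-defects : defPair a b + (defPair a c + defPair b c)
                       ≡ defV G α v₀ + (defV G α v₁ + defV G α v₂)
      triangle-defects = begin
        defPair a b + (defPair a c + defPair b c)
          ≡⟨ cong₂ (λ x y → defPair a b + (defPair x c + y))
                   (symm v₀ v₁ refl) (cong₂ defPair (symm v₀ v₂ refl) (symm v₁ v₂ refl)) ⟩
        defPair (α v₀ v₁) (α v₀ v₂) + (defPair (α v₁ v₀) (α v₁ v₂) + defPair (α v₂ v₀) (α v₂ v₁))
          ≡⟨ sym (cong₂ _+_ (defV-v₀ α) (cong₂ _+_ (defV-v₁ α) (defV-v₂ α))) ⟩
        defV G α v₀ + (defV G α v₁ + defV G α v₂) ∎

    3≤t : 3 ≤ t
    3≤t = distinct-bounded⇒3≤ a≢b a≢c b≢c (range v₀ v₁ refl) (range v₀ v₂ refl) (range v₁ v₂ refl)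

  rung-bound : ∀ {j} → j < l → suc (j + j) < l + l
  rung-bound {j} j<l = subst (_≤ l + l) (sym (2+m+m≡1+m+1+m j)) (+-mono-≤ j<l j<l)

  rung-low<N : ∀ {j} → j < l → 3 + (j + j) < N
  rung-low<N j<l = s≤s (s≤s (s≤s (<-trans (n<1+n _) (rung-bound j<l))))

  rung-high<N : ∀ {j} → j < l → 3 + suc (j + j) < N
  rung-high<N j<l = s≤s (s≤s (s≤s (rung-bound j<l)))

  rung-low rung-high : ∀ {j} → j < l → Fin N
  rung-low  j<l = fromℕ< (rung-low<N j<l)
  rung-high j<l = fromℕ< (rung-high<N j<l)

  toℕ-rung-low : ∀ {j} (j<l : j < l) → toℕ (rung-low j<l) ≡ 3 + (j + j)
  toℕ-rung-low j<l = toℕ-fromℕ< (rung-low<N j<l)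

  toℕ-rung-high : ∀ {j} (j<l : j < l) → toℕ (rung-high j<l) ≡ 3 + suc (j + j)
  toℕ-rung-high j<l = toℕ-fromℕ< (rung-high<N j<l)

  src tgt : Fin (3 + l) → Fin N
  src fz                = v₀
  src (fs fz)           = v₀
  src (fs (fs fz))      = v₁
  src (fs (fs (fs j)))  = rung-low (toℕ<n j)
  tgt fz                = v₁
  tgt (fs fz)           = v₂
  tgt (fs (fs fz))      = v₂
  tgt (fs (fs (fs j)))  = rung-high (toℕ<n j)

  rung-index : ∀ {j} → j < l → Fin (3 + l)
  rung-index j<l = fs (fs (fs (fromℕ< j<l)))

  rung-ends : ∀ {j} (j<l : j < l) →
    toℕ (src (rung-index j<l)) ≡ 3 + (j + j) × toℕ (tgt (rung-index j<l)) ≡ 3 + suc (j + j)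
  rung-ends j<l =
    trans (toℕ-rung-low (toℕ<n (fromℕ< j<l))) (cong (λ k → 3 + (k + k)) (toℕ-fromℕ< j<l)) ,
    trans (toℕ-rung-high (toℕ<n (fromℕ< j<l))) (cong (λ k → 3 + suc (k + k)) (toℕ-fromℕ< j<l))

  Edge-covered : ∀ {a b} → Edge a b → a < N →
    ∃ λ i → (toℕ (src i) ≡ a × toℕ (tgt i) ≡ b) ⊎ (toℕ (src i) ≡ b × toℕ (tgt i) ≡ a)
  Edge-covered edge₀₁ _ = fz , inj₁ (refl , refl)
  Edge-covered edge₀₂ _ = fs fz , inj₁ (refl , refl)
  Edge-covered edge₁₀ _ = fz , inj₂ (refl , refl)
  Edge-covered edge₁₂ _ = fs (fs fz) , inj₁ (refl , refl)
  Edge-covered edge₂₀ _ = fs fz , inj₂ (refl , refl)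
  Edge-covered edge₂₁ _ = fs (fs fz) , inj₂ (refl , refl)
  Edge-covered (rung p) (s≤s (s≤s (s≤s x<l+l))) with Partners⇒double p
  ... | j , inj₁ (refl , refl) = rung-index j<l , inj₁ (rung-ends j<l)
    where j<l = m+m<n+n⇒m<n {j} x<l+l
  ... | j , inj₂ (refl , refl) = rung-index j<l , inj₂ (rung-ends j<l)
    where j<l = m+m<n+n⇒m<n {j} (<-trans (n<1+n _) x<l+l)

  covers : Covers G src tgt
  covers u v uv with Edge-covered (adjℕ⇒Edge {toℕ u} {toℕ v} uv) (toℕ<n u)
  ... | i , inj₁ (src≡u , tgt≡v) = i , inj₁ (toℕ-injective src≡u , toℕ-injective tgt≡v)
  ... | i , inj₂ (src≡v , tgt≡u) = i , inj₂ (toℕ-injective src≡v , toℕ-injective tgt≡u)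

  t≤3+l : ∀ {t α} → Proper G t α → t ≤ 3 + l
  t≤3+l = colours≤edges G covers

  rung-adjacent : ∀ {j} (j<l : j < l) → adj G (rung-low j<l) (rung-high j<l) ≡ true
  rung-adjacent {j} j<l = subst₂ (λ a b → adjℕ a b ≡ true)
    (sym (toℕ-rung-low j<l)) (sym (toℕ-rung-high j<l)) (Edge⇒adjℕ (rung (Partners-double j)))

  colourℕ : (ℕ → ℕ) → ℕ → ℕ → ℕ
  colourℕ h (suc (suc (suc x))) _ = h x
  colourℕ _ a                   b = a + b

  colouring : (ℕ → ℕ) → Colouring G
  colouring h u v = colourℕ h (toℕ u) (toℕ v)

  module RungColouring (h : ℕ → ℕ) where

    colourℕ-injective : ∀ {a b c} → Edge a b → Edge a c → colourℕ h a b ≡ colourℕ h a c → b ≡ c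
    colourℕ-injective {0} _ _ eq = eq
    colourℕ-injective {1} _ _ eq = suc-injective eq
    colourℕ-injective {2} _ _ eq = suc-injective (suc-injective eq)
    colourℕ-injective (rung p) (rung q) _ = cong (3 +_) (Partners-functional p q)

    rung-colour : ∀ {j} (j<l : j < l) → colouring h (rung-low j<l) (rung-high j<l) ≡ h (j + j)
    rung-colour {j} j<l =
      cong (λ a → colourℕ h a (toℕ (rung-high j<l))) (toℕ-rung-low j<l)

    defG≡1 : defG G (colouring h) ≡ 1
    defG≡1 = cong₂ _+_ (defV-v₀ α) (cong₂ _+_ (defV-v₁ α) (cong₂ _+_ (defV-v₂ α) rungs-defect-free))
      where
      α = colouring h
      rungs-defect-free : sum (map (defV G α) rung-vertices) ≡ 0
      rungs-defect-free = sum-map-zero (tabulate⁺ λ i →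
        defSet-const (h (toℕ i)) (neighbours (fs (fs (fs i)))))

    proper : ∀ {t} → 3 ≤ t →
      (∀ {x y} → Partners x y → h x ≡ h y) →
      (∀ x → x < l + l → 1 ≤ h x × h x ≤ t) →
      (∀ j → 4 + j ≤ t → ∃ λ r → r < l × h (r + r) ≡ 4 + j) →
      Proper G t (colouring h)
    proper {t} 3≤t h-partners h-range h-onto = record
      { symm   = λ u v uv → colourℕ-sym (adjℕ⇒Edge {toℕ u} {toℕ v} uv)
      ; range  = λ u v uv → colourℕ-range (adjℕ⇒Edge {toℕ u} {toℕ v} uv) (toℕ<n u)
      ; used   = used
      ; proper = λ u v w uv uw v≢w eq →
          v≢w (toℕ-injective (colourℕ-injective (adjℕ⇒Edge {toℕ u} uv) (adjℕ⇒Edge {toℕ u} uw) eq))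
      }
      where
      colourℕ-sym : ∀ {a b} → Edge a b → colourℕ h a b ≡ colourℕ h b a
      colourℕ-sym edge₀₁   = refl
      colourℕ-sym edge₀₂   = refl
      colourℕ-sym edge₁₀   = refl
      colourℕ-sym edge₁₂   = refl
      colourℕ-sym edge₂₀   = refl
      colourℕ-sym edge₂₁   = refl
      colourℕ-sym (rung p) = h-partners p

      1≤t : 1 ≤ t
      1≤t = ≤-trans (s≤s z≤n) 3≤t

      2≤t : 2 ≤ t
      2≤t = ≤-trans (s≤s (s≤s z≤n)) 3≤t

      colourℕ-range : ∀ {a b} → Edge a b → a < N → 1 ≤ colourℕ h a b × colourℕ h a b ≤ t
      colourℕ-range edge₀₁   _ = s≤s z≤n , 1≤t
      colourℕ-range edge₀₂   _ = s≤s z≤n , 2≤t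
      colourℕ-range edge₁₀   _ = s≤s z≤n , 1≤t
      colourℕ-range edge₁₂   _ = s≤s z≤n , 3≤t
      colourℕ-range edge₂₀   _ = s≤s z≤n , 2≤t
      colourℕ-range edge₂₁   _ = s≤s z≤n , 3≤t
      colourℕ-range {suc (suc (suc x))} (rung p) (s≤s (s≤s (s≤s x<l+l))) = h-range x x<l+l

      used : ∀ c → 1 ≤ c → c ≤ t → ∃ λ u → ∃ λ v → adj G u v ≡ true × colouring h u v ≡ c
      used 1 _ _ = v₀ , v₁ , refl , refl
      used 2 _ _ = v₀ , v₂ , refl , refl
      used 3 _ _ = v₁ , v₂ , refl , refl
      used (suc (suc (suc (suc j)))) _ c≤t with h-onto j c≤t
      ... | r , r<l , hr≡c =
        rung-low r<l , rung-high r<l , rung-adjacent r<l , trans (rung-colour r<l) hr≡c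

  h₃ h₃₊ₗ : ℕ → ℕ
  h₃   _ = 1
  h₃₊ₗ x = 4 + ⌊ x /2⌋

  module R₃ = RungColouring h₃
  module R₃₊ₗ = RungColouring h₃₊ₗ

  proper₃ : Proper G 3 (colouring h₃)
  proper₃ = R₃.proper ≤-refl (λ _ → refl) (λ _ _ → s≤s z≤n , s≤s z≤n) λ { _ (s≤s (s≤s (s≤s ()))) }

  proper₃₊ₗ : Proper G (3 + l) (colouring h₃₊ₗ)
  proper₃₊ₗ = R₃₊ₗ.proper (s≤s (s≤s (s≤s z≤n)))
    (cong (4 +_) ∘ Partners-⌊/2⌋)
    (λ _ x<l+l → s≤s z≤n , s≤s (s≤s (s≤s (⌊m/2⌋<n x<l+l))))
    (λ j 4+j≤3+l → j , s≤s⁻¹ (s≤s⁻¹ (s≤s⁻¹ 4+j≤3+l)) , cong (4 +_) (sym (n≡⌊n+n/2⌋ j)))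

  isDef : IsDef G 1
  isDef = (3 , colouring h₃ , proper₃ , R₃.defG≡1) , λ _ _ → TriangleColours.defG-pos

  optimal : ∀ {t α} → Proper G t α → defG G α ≡ 1 → OptT G t
  optimal = minimal⇒optimal (proj₂ isDef)

  isWdefMin : IsWdefMin G 3
  isWdefMin = optimal proper₃ R₃.defG≡1 , λ _ (_ , pr , _) → TriangleColours.3≤t pr

  isWdefMax : IsWdefMax G (3 + l)
  isWdefMax = optimal proper₃₊ₗ R₃₊ₗ.defG≡1 , λ _ (_ , pr , _) → t≤3+l pr

theorem2p4 : ∀ (l : ℕ) → 1 ≤ l →
    ∃ λ (G : Graph) → ∃ λ (d : ℕ) → ∃ λ (w : ℕ) → ∃ λ (W : ℕ) →
      IsDef G d × 0 < d × IsWdefMin G w × IsWdefMax G W × w + l ≤ W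
theorem2p4 l _ = G , 1 , 3 , 3 + l , isDef , s≤s z≤n , isWdefMin , isWdefMax , ≤-refl
  where open TriangleAndMatching l
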